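{- Let $p_1,\dots,p_k$ be distinct primes, $q_1,\dots,q_k$ distinct primes, and $\alpha_1,\dots,\alpha_k\ge1$. Set $m=p_1^{\alpha_1}\cdots p_k^{\alpha_k}$ and $m'=q_1^{\alpha_1}\cdots q_k^{\alpha_k}$, and define $\mu\colon\mathrm{div}(m)\to\mathrm{div}(m')$ by $\mu(p_1^{\beta_1}\cdots p_k^{\beta_k})=q_1^{\beta_1}\cdots q_k^{\beta_k}$. Then for all $m_1,\dots,m_t\in\mathrm{div}(m)$ the minor homomorphism poset of the MV-algebra $\mathbf L_{m_1}\times\cdots\times\mathbf L_{m_t}$ is isomorphic to the minor homomorphism poset of the MV-algebra $\mathbf L_{\mu(m_1)}\times\cdots\times\mathbf L_{\mu(m_t)}$.
   Context: The standard MV-algebra is $\langle[0,1],\oplus,\odot,\neg,0,1\rangle$ with $x\oplus y=\min(1,x+y)$, $x\odot y=\max(0,x+y-1)$, $\neg x=1-x$. For $m\ge1$, $\mathbf L_m$ is its subalgebra with universe $\{0,\frac1m,\dots,\frac{m-1}m,1\}$; $\mathrm{div}(m)$ is the set of positive divisors of $m$. For an algebra $\mathbf A$, its minor homomorphism poset is $(H/{\equiv},\le)$ where $H$ is the set of all homomorphisms $\mathbf A^n\to\mathbf A$, $n\ge1$; here for $\tau\colon[n]\to[m]$ ($[n]=\{1,\dots,n\}$), $\tau^A(a_1,\dots,a_m)=(a_{\tau(1)},\dots,a_{\tau(n)})$, $g\preceq f$ iff $g=f\circ\tau^A$ for some $\tau$, $\equiv$ is the induced equivalence, and $[g]\le[f]$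 iff $g\preceq f$. -}

module Defs where

open import Data.Nat using (ℕ; zero; suc; _+_; _*_; _∸_; _^_; _≤_)
open import Data.Fin using (Fin; zero; suc; toℕ; fromℕ)
open import Data.Vec using (Vec; []; _∷_; zipWith; map; replicate; tabulate; lookup)
open import Data.Product using (Σ; _×_; _,_; ∃)
open import Relation.Binary.PropositionalEquality using (_≡_)

record Alg : Set₁ where
  field
    Carrier : Set
    _⊕_ _⊙_ : Carrier → Carrier → Carrier
    neg     : Carrier → Carrier
    zero₀ one₁ : Carrier

open Alg public

-- The finite MV-chain L_m, with the element i/m represented by i : Fin (m+1).

cap : (m : ℕ) → ℕ → Fin (suc m)
cap zero    k       = zero
cap (suc m) zero    = zero
cap (suc m) (suc k) = suc (cap m k)

L : ℕ → Alg
L m = record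
  { Carrier = Fin (suc m)
  ; _⊕_     = λ x y → cap m (toℕ x + toℕ y)
  ; _⊙_     = λ x y → cap m ((toℕ x + toℕ y) ∸ m)
  ; neg     = λ x → cap m (m ∸ toℕ x)
  ; zero₀   = zero
  ; one₁    = fromℕ m
  }

_×A_ : Alg → Alg → Alg
A ×A B = record
  { Carrier = Carrier A × Carrier B
  ; _⊕_     = λ { (a , b) (a' , b') → (_⊕_ A a a' , _⊕_ B b b') }
  ; _⊙_     = λ { (a , b) (a' , b') → (_⊙_ A a a' , _⊙_ B b b') }
  ; neg     = λ { (a , b) → (neg A a , neg B b) }
  ; zero₀   = (zero₀ A , zero₀ B)
  ; one₁    = (one₁ A , one₁ B)
  }

ProdL : ∀ {t} → Vec ℕ (suc t) → Alg
ProdL (m ∷ [])     = L m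
ProdL (m ∷ n ∷ ms) = L m ×A ProdL (n ∷ ms)

-- Homomorphisms A^n → A (n ≥ 1; arity stored as n = suc ar), A^n = Vec

record Hom (A : Alg) : Set where
  field
    ar : ℕ
    fn : Vec (Carrier A) (suc ar) → Carrier A
    pres-⊕ : ∀ x y → fn (zipWith (_⊕_ A) x y) ≡ _⊕_ A (fn x) (fn y)
    pres-⊙ : ∀ x y → fn (zipWith (_⊙_ A) x y) ≡ _⊙_ A (fn x) (fn y)
    pres-¬ : ∀ x → fn (map (neg A) x) ≡ neg A (fn x)
    pres-0 : fn (replicate (suc ar) (zero₀ A)) ≡ zero₀ A
    pres-1 : fn (replicate (suc ar) (one₁ A)) ≡ one₁ A

open Hom public

minorMap : ∀ {C : Set} {n m} → (Fin n → Fin m) → Vec C m → Vec C n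
minorMap τ a = tabulate (λ i → lookup a (τ i))

_⪯_ : ∀ {A} → Hom A → Hom A → Set
_⪯_ {A} g f = Σ (Fin (suc (ar f)) → Fin (suc (ar g)))
                 (λ τ → ∀ a → fn g a ≡ fn f (minorMap τ a))

_≋_ : ∀ {A} → Hom A → Hom A → Set
g ≋ f = g ⪯ f × f ⪯ g

-- Without quotient types: maps on representatives, both monotone w.r.t. ⪯,
-- mutually inverse up to ≡.  (Monotone maps respect ≡, hence descend to the
-- quotients, where they are mutually inverse order-preserving maps.)
MinorPosetIso : Alg → Alg → Set
MinorPosetIso A B =
  Σ (Hom A → Hom B) λ F →
  Σ (Hom B → Hom A) λ G →
    (∀ g f → g ⪯ f → F g ⪯ F f) ×
    (∀ g f → g ⪯ f → G g ⪯ G f) ×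
    (∀ f → G (F f) ≋ f) ×
    (∀ f → F (G f) ≋ f)

∏ : ∀ k → (Fin k → ℕ) → ℕ
∏ zero    f = 1
∏ (suc k) f = f zero * ∏ k (λ i → f (suc i))

primePow : ∀ k → (Fin k → ℕ) → (Fin k → ℕ) → ℕ
primePow k p β = ∏ k (λ i → p i ^ β i)

-- In A = L_{m_1} × ⋯ × L_{m_t}, output coordinate j of a homomorphism h : A^n → A is itself a
-- homomorphism A^n → L_{m_j}.  Multiplying by the "unit" vectors (top in one position, 0 elsewhere)
-- shows it depends on a single input position (i , j'), through a homomorphism L_{m_j'} → L_{m_j};
-- such a homomorphism exists only if m_j' ∣ m_j and is then x ↦ (m_j / m_j') x.  Conversely every
-- choice of positions respecting divisibility is a homomorphism, and minors merely reindex the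
-- positions.  So the minor poset depends only on the divisibility relation among m_1, …, m_t, which
-- μ preserves and reflects because divisibility of prime powers is comparison of exponents.

module Submission where

open import Defs
open import Data.Bool using (if_then_else_)
open import Data.Empty using (⊥-elim)
open import Data.Fin using (Fin; zero; suc; toℕ)
import Data.Fin.Properties as Fin
open import Data.List using (List; []; _∷_; cartesianProduct; allFin)
open import Data.List.Membership.Propositional using (_∈_)
open import Data.List.Membership.Propositional.Properties using (∈-cartesianProduct⁺; ∈-allFin)
open import Data.List.Relation.Unary.Any using (here; there)
open import Data.Nat using (ℕ; zero; suc; _+_; _*_; _∸_; _^_; _≤_; _<_; _⊓_; z≤n; s≤s; nonTrivial⇒n>1; nonTrivial⇒≢1; >-nonZero)
open import Data.Nat.Divisibility
open import Data.Nat.DivMod using (_/_; m*[n/m]≡n; m*n/n≡m)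
open import Data.Nat.Primality using (Prime; euclidsLemma; prime⇒nonTrivial; prime⇒irreducible; prime⇒nonZero)
open import Data.Nat.Properties
open import Data.Product using (∃; _×_; _,_; proj₁; proj₂)
open import Data.Product.Properties using (≡-dec)
open import Data.Sum using (inj₁; inj₂)
open import Data.Vec using (Vec; []; _∷_; lookup; tabulate; zipWith; map; replicate)
open import Data.Vec.Properties using (lookup∘tabulate; lookup-zipWith; lookup-map; lookup-replicate; tabulate∘lookup)
open import Function.Definitions using (Injective)
open import Relation.Binary.Definitions using (DecidableEquality)
open import Relation.Binary.PropositionalEquality
open import Relation.Nullary using (¬_; yes; no; does)
open import Relation.Nullary.Decidable using (dec-true; dec-false; decidable-stable)
open import Relation.Unary using (Decidable)

toℕ-cap : ∀ m k → toℕ (cap m k) ≡ m ⊓ k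
toℕ-cap zero    k       = refl
toℕ-cap (suc m) zero    = refl
toℕ-cap (suc m) (suc k) = cong suc (toℕ-cap m k)

-- Numerators of the operations of L_c: (a/c) ⊕ (b/c) = (a ⊕⟨ c ⟩ b)/c, etc.
infixl 6 _⊕⟨_⟩_ _⊙⟨_⟩_

_⊕⟨_⟩_ : ℕ → ℕ → ℕ → ℕ
a ⊕⟨ c ⟩ b = c ⊓ (a + b)

_⊙⟨_⟩_ : ℕ → ℕ → ℕ → ℕ
a ⊙⟨ c ⟩ b = c ⊓ ((a + b) ∸ c)

¬⟨_⟩_ : ℕ → ℕ → ℕ
¬⟨ c ⟩ a = c ⊓ (c ∸ a)

⊕⟨⟩-identityʳ : ∀ {c a} → a ≤ c → a ⊕⟨ c ⟩ 0 ≡ a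
⊕⟨⟩-identityʳ {c} {a} a≤c = trans (cong (c ⊓_) (+-identityʳ a)) (m≥n⇒m⊓n≡n a≤c)

⊕⟨⟩-absorbs-topˡ : ∀ c a → c ⊕⟨ c ⟩ a ≡ c
⊕⟨⟩-absorbs-topˡ c a = m≤n⇒m⊓n≡m (m≤m+n c a)

⊕⟨⟩-absorbs-topʳ : ∀ c a → a ⊕⟨ c ⟩ c ≡ c
⊕⟨⟩-absorbs-topʳ c a = m≤n⇒m⊓n≡m (m≤n+m c a)

⊕⟨⟩-truncateˡ : ∀ c a b → (c ⊓ a) ⊕⟨ c ⟩ b ≡ a ⊕⟨ c ⟩ b
⊕⟨⟩-truncateˡ c a b with ≤-total a c
... | inj₁ a≤c rewrite m≥n⇒m⊓n≡n a≤c = refl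
... | inj₂ c≤a rewrite m≤n⇒m⊓n≡m c≤a =
  trans (⊕⟨⟩-absorbs-topˡ c b) (sym (m≤n⇒m⊓n≡m (≤-trans c≤a (m≤m+n a b))))

⊕⟨⟩-idempotent⇒top : ∀ {c a} → a ⊕⟨ c ⟩ a ≡ a → a ≢ 0 → a ≡ c
⊕⟨⟩-idempotent⇒top {c} {a} idem a≢0 with ≤-total (a + a) c
... | inj₁ a+a≤c = ⊥-elim (a≢0 (+-cancelˡ-≡ a a 0 (trans a+a≡a (sym (+-identityʳ a)))))
  where
  a+a≡a : a + a ≡ a
  a+a≡a = trans (sym (m≥n⇒m⊓n≡n a+a≤c)) idem
... | inj₂ c≤a+a = trans (sym idem) (m≤n⇒m⊓n≡m c≤a+a)

¬⟨⟩-top : ∀ c → ¬⟨ c ⟩ c ≡ 0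
¬⟨⟩-top c = trans (cong (c ⊓_) (n∸n≡0 c)) (⊓-zeroʳ c)

⊙⟨⟩-identityʳ : ∀ {c a} → a ≤ c → a ⊙⟨ c ⟩ c ≡ a
⊙⟨⟩-identityʳ {c} {a} a≤c = trans (cong (c ⊓_) (m+n∸n≡m a c)) (m≥n⇒m⊓n≡n a≤c)

⊙⟨⟩-zeroʳ : ∀ {c a} → a ≤ c → a ⊙⟨ c ⟩ 0 ≡ 0
⊙⟨⟩-zeroʳ {c} {a} a≤c =
  trans (cong (λ x → c ⊓ (x ∸ c)) (+-identityʳ a)) (trans (cong (c ⊓_) (m≤n⇒m∸n≡0 a≤c)) (⊓-zeroʳ c))

*-distribʳ-⊕⟨⟩ : ∀ k c a b → (a ⊕⟨ c ⟩ b) * k ≡ (a * k) ⊕⟨ c * k ⟩ (b * k)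
*-distribʳ-⊕⟨⟩ k c a b =
  trans (*-distribʳ-⊓ k c (a + b)) (cong ((c * k) ⊓_) (*-distribʳ-+ k a b))

*-distribʳ-⊙⟨⟩ : ∀ k c a b → (a ⊙⟨ c ⟩ b) * k ≡ (a * k) ⊙⟨ c * k ⟩ (b * k)
*-distribʳ-⊙⟨⟩ k c a b = begin
  (c ⊓ ((a + b) ∸ c)) * k                ≡⟨ *-distribʳ-⊓ k c _ ⟩
  (c * k) ⊓ (((a + b) ∸ c) * k)          ≡⟨ cong ((c * k) ⊓_) (*-distribʳ-∸ k (a + b) c) ⟩
  (c * k) ⊓ ((a + b) * k ∸ c * k)        ≡⟨ cong (λ x → (c * k) ⊓ (x ∸ c * k)) (*-distribʳ-+ k a b) ⟩
  (c * k) ⊓ ((a * k + b * k) ∸ c * k)    ∎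
  where open ≡-Reasoning

*-distribʳ-¬⟨⟩ : ∀ k c a → (¬⟨ c ⟩ a) * k ≡ ¬⟨ c * k ⟩ (a * k)
*-distribʳ-¬⟨⟩ k c a =
  trans (*-distribʳ-⊓ k c (c ∸ a)) (cong ((c * k) ⊓_) (*-distribʳ-∸ k c a))

m∸n≡m⇒n≡0 : ∀ {m n} → 0 < m → m ∸ n ≡ m → n ≡ 0
m∸n≡m⇒n≡0 {n = zero}        _ _  = refl
m∸n≡m⇒n≡0 {suc m} {suc n} _ eq = ⊥-elim (n≮n m (subst (_≤ m) eq (m∸n≤m m n)))

-- φ is a homomorphism L_c' → L_c read on numerators.
module ChainHom {c c' : ℕ} (1≤c : 1 ≤ c) (1≤c' : 1 ≤ c') (φ : ℕ → ℕ)
  (φ-top : φ c' ≡ c)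
  (φ-⊕ : ∀ {a b} → a ≤ c' → b ≤ c' → φ (a ⊕⟨ c' ⟩ b) ≡ φ a ⊕⟨ c ⟩ φ b)
  (φ-¬ : ∀ {a} → a ≤ c' → φ (¬⟨ c' ⟩ a) ≡ ¬⟨ c ⟩ φ a)
  where

  open ≡-Reasoning

  slope : ℕ
  slope = φ 1

  φ-zero : φ 0 ≡ 0
  φ-zero = begin
    φ 0              ≡⟨ cong φ (sym (¬⟨⟩-top c')) ⟩
    φ (¬⟨ c' ⟩ c')   ≡⟨ φ-¬ ≤-refl ⟩
    ¬⟨ c ⟩ φ c'      ≡⟨ cong (¬⟨ c ⟩_) φ-top ⟩
    ¬⟨ c ⟩ c         ≡⟨ ¬⟨⟩-top c ⟩
    0                ∎

  slope≤c : slope ≤ c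
  slope≤c = subst (_≤ c) slope⊕0≡slope (m⊓n≤m c _)
    where
    slope⊕0≡slope : slope ⊕⟨ c ⟩ φ 0 ≡ slope
    slope⊕0≡slope = trans (sym (φ-⊕ 1≤c' z≤n)) (cong φ (⊕⟨⟩-identityʳ 1≤c'))

  φ-truncated-linear : ∀ {a} → a ≤ c' → φ a ≡ c ⊓ (a * slope)
  φ-truncated-linear {zero}  _      = trans φ-zero (sym (⊓-zeroʳ c))
  φ-truncated-linear {suc a} 1+a≤c' = begin
    φ (suc a)                          ≡⟨ cong φ (sym a⊕1≡1+a) ⟩
    φ (a ⊕⟨ c' ⟩ 1)                    ≡⟨ φ-⊕ a≤c' 1≤c' ⟩
    φ a ⊕⟨ c ⟩ slope                   ≡⟨ cong (_⊕⟨ c ⟩ slope) (φ-truncated-linear a≤c') ⟩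
    (c ⊓ (a * slope)) ⊕⟨ c ⟩ slope     ≡⟨ ⊕⟨⟩-truncateˡ c (a * slope) slope ⟩
    c ⊓ (a * slope + slope)            ≡⟨ cong (c ⊓_) (+-comm (a * slope) slope) ⟩
    c ⊓ (suc a * slope)                ∎
    where
    a≤c' : a ≤ c'
    a≤c' = ≤-trans (n≤1+n a) 1+a≤c'
    a⊕1≡1+a : a ⊕⟨ c' ⟩ 1 ≡ suc a
    a⊕1≡1+a = trans (cong (c' ⊓_) (+-comm a 1)) (m≥n⇒m⊓n≡n 1+a≤c')

  slope≢0 : slope ≢ 0
  slope≢0 slope≡0 = <⇒≱ 1≤c (subst (c ≤_) (trans (cong (c' *_) slope≡0) (*-zeroʳ c')) c≤c'*slope)
    where
    c≤c'*slope : c ≤ c' * slope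
    c≤c'*slope = subst (_≤ c' * slope) (trans (sym (φ-truncated-linear ≤-refl)) φ-top) (m⊓n≤n c _)

  -- Evaluating at c' - 1 = ¬ 1 pins the slope down.
  φ-pred : φ (c' ∸ 1) ≡ c ∸ slope
  φ-pred = begin
    φ (c' ∸ 1)         ≡⟨ cong φ (sym (m≥n⇒m⊓n≡n (m∸n≤m c' 1))) ⟩
    φ (¬⟨ c' ⟩ 1)      ≡⟨ φ-¬ 1≤c' ⟩
    c ⊓ (c ∸ slope)    ≡⟨ m≥n⇒m⊓n≡n (m∸n≤m c slope) ⟩
    c ∸ slope          ∎

  c≡c'*slope : c ≡ c' * slope
  c≡c'*slope with ≤-total ((c' ∸ 1) * slope) c
  ... | inj₁ pred*slope≤c = sym (begin
    c' * slope                      ≡⟨ cong (_* slope) (sym (m+[n∸m]≡n 1≤c')) ⟩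
    slope + (c' ∸ 1) * slope        ≡⟨ cong (slope +_) (sym (m≥n⇒m⊓n≡n pred*slope≤c)) ⟩
    slope + c ⊓ ((c' ∸ 1) * slope)  ≡⟨ cong (slope +_) (trans (sym (φ-truncated-linear (m∸n≤m c' 1))) φ-pred) ⟩
    slope + (c ∸ slope)             ≡⟨ m+[n∸m]≡n slope≤c ⟩
    c                               ∎)
  ... | inj₂ c≤pred*slope = ⊥-elim (slope≢0 (m∸n≡m⇒n≡0 1≤c c∸slope≡c))
    where
    c∸slope≡c : c ∸ slope ≡ c
    c∸slope≡c = trans (sym φ-pred) (trans (φ-truncated-linear (m∸n≤m c' 1)) (m≤n⇒m⊓n≡m c≤pred*slope))

  c'∣c : c' ∣ c
  c'∣c = divides slope (trans c≡c'*slope (*-comm c' slope))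

  slope≡c/c' : slope ≡ _/_ c c' {{>-nonZero 1≤c'}}
  slope≡c/c' = sym (trans (cong (λ m → _/_ m c' {{>-nonZero 1≤c'}}) (trans c≡c'*slope (*-comm c' slope)))
                          (m*n/n≡m slope c' {{>-nonZero 1≤c'}}))

  φ-linear : ∀ {a} → a ≤ c' → φ a ≡ a * slope
  φ-linear {a} a≤c' = trans (φ-truncated-linear a≤c')
    (m≥n⇒m⊓n≡n (subst (a * slope ≤_) (sym c≡c'*slope) (*-monoˡ-≤ slope a≤c')))

coord : ∀ {t} (v : Vec ℕ (suc t)) → Carrier (ProdL v) → Fin (suc t) → ℕ
coord (m ∷ [])     x       zero    = toℕ x
coord (m ∷ n ∷ ms) (x , y) zero    = toℕ x
coord (m ∷ n ∷ ms) (x , y) (suc j) = coord (n ∷ ms) y j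

fromCoords : ∀ {t} (v : Vec ℕ (suc t)) → (Fin (suc t) → ℕ) → Carrier (ProdL v)
fromCoords (m ∷ [])     f = cap m (f zero)
fromCoords (m ∷ n ∷ ms) f = cap m (f zero) , fromCoords (n ∷ ms) (λ j → f (suc j))

coord-fromCoords : ∀ {t} (v : Vec ℕ (suc t)) f j → coord v (fromCoords v f) j ≡ lookup v j ⊓ f j
coord-fromCoords (m ∷ [])     f zero    = toℕ-cap m (f zero)
coord-fromCoords (m ∷ n ∷ ms) f zero    = toℕ-cap m (f zero)
coord-fromCoords (m ∷ n ∷ ms) f (suc j) = coord-fromCoords (n ∷ ms) (λ j → f (suc j)) j

coord≤ : ∀ {t} (v : Vec ℕ (suc t)) x j → coord v x j ≤ lookup v j
coord≤ (m ∷ [])     x       zero    = Fin.toℕ≤pred[n] x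
coord≤ (m ∷ n ∷ ms) (x , y) zero    = Fin.toℕ≤pred[n] x
coord≤ (m ∷ n ∷ ms) (x , y) (suc j) = coord≤ (n ∷ ms) y j

coord-injective : ∀ {t} (v : Vec ℕ (suc t)) {x y} → (∀ j → coord v x j ≡ coord v y j) → x ≡ y
coord-injective (m ∷ [])                     eq = Fin.toℕ-injective (eq zero)
coord-injective (m ∷ n ∷ ms) {x , y} {x' , y'} eq =
  cong₂ _,_ (Fin.toℕ-injective (eq zero)) (coord-injective (n ∷ ms) (λ j → eq (suc j)))

coord-⊕ : ∀ {t} (v : Vec ℕ (suc t)) x y j →
          coord v (_⊕_ (ProdL v) x y) j ≡ coord v x j ⊕⟨ lookup v j ⟩ coord v y j
coord-⊕ (m ∷ [])     x       y         zero    = toℕ-cap m _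
coord-⊕ (m ∷ n ∷ ms) (x , y) (x' , y') zero    = toℕ-cap m _
coord-⊕ (m ∷ n ∷ ms) (x , y) (x' , y') (suc j) = coord-⊕ (n ∷ ms) y y' j

coord-⊙ : ∀ {t} (v : Vec ℕ (suc t)) x y j →
          coord v (_⊙_ (ProdL v) x y) j ≡ coord v x j ⊙⟨ lookup v j ⟩ coord v y j
coord-⊙ (m ∷ [])     x       y         zero    = toℕ-cap m _
coord-⊙ (m ∷ n ∷ ms) (x , y) (x' , y') zero    = toℕ-cap m _
coord-⊙ (m ∷ n ∷ ms) (x , y) (x' , y') (suc j) = coord-⊙ (n ∷ ms) y y' j

coord-¬ : ∀ {t} (v : Vec ℕ (suc t)) x j → coord v (neg (ProdL v) x) j ≡ ¬⟨ lookup v j ⟩ coord v x j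
coord-¬ (m ∷ [])     x       zero    = toℕ-cap m _
coord-¬ (m ∷ n ∷ ms) (x , y) zero    = toℕ-cap m _
coord-¬ (m ∷ n ∷ ms) (x , y) (suc j) = coord-¬ (n ∷ ms) y j

coord-0 : ∀ {t} (v : Vec ℕ (suc t)) j → coord v (zero₀ (ProdL v)) j ≡ 0
coord-0 (m ∷ [])     zero    = refl
coord-0 (m ∷ n ∷ ms) zero    = refl
coord-0 (m ∷ n ∷ ms) (suc j) = coord-0 (n ∷ ms) j

coord-1 : ∀ {t} (v : Vec ℕ (suc t)) j → coord v (one₁ (ProdL v)) j ≡ lookup v j
coord-1 (m ∷ [])     zero    = Fin.toℕ-fromℕ m
coord-1 (m ∷ n ∷ ms) zero    = Fin.toℕ-fromℕ m
coord-1 (m ∷ n ∷ ms) (suc j) = coord-1 (n ∷ ms) j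

¬∀⟶∃¬-× : ∀ m n {p} (P : Fin m × Fin n → Set p) → Decidable P → ¬ (∀ s → P s) → ∃ λ s → ¬ P s
¬∀⟶∃¬-× m n P P? ¬∀P
  with Fin.¬∀⟶∃¬ m (λ i → ∀ j → P (i , j)) (λ i → Fin.all? (λ j → P? (i , j))) (λ ∀∀P → ¬∀P (λ (i , j) → ∀∀P i j))
... | i , ¬∀jP with Fin.¬∀⟶∃¬ n (λ j → P (i , j)) (λ j → P? (i , j)) ¬∀jP
... | j , ¬P = (i , j) , ¬P

module ProductHoms {t} (v : Vec ℕ (suc t)) (v-positive : ∀ j → 1 ≤ lookup v j) where

  A : Alg
  A = ProdL v

  C : Set
  C = Carrier A

  c : Fin (suc t) → ℕ
  c = lookup v

  -- Position (i , j) of A^n: the j-th coordinate of the i-th argument.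
  Pos : ℕ → Set
  Pos n = Fin n × Fin (suc t)

  _≟ₚ_ : ∀ {n} → DecidableEquality (Pos n)
  _≟ₚ_ = ≡-dec Fin._≟_ Fin._≟_

  height : ∀ {n} → Pos n → ℕ
  height (_ , j) = c j

  entry : ∀ {n} → Vec C n → Pos n → ℕ
  entry x (i , j) = coord v (lookup x i) j

  fromEntries : ∀ {n} → (Pos n → ℕ) → Vec C n
  fromEntries f = tabulate (λ i → fromCoords v (λ j → f (i , j)))

  entry-fromEntries : ∀ {n} (f : Pos n → ℕ) s → entry (fromEntries f) s ≡ height s ⊓ f s
  entry-fromEntries f (i , j) =
    trans (cong (λ z → coord v z j) (lookup∘tabulate _ i)) (coord-fromCoords v _ j)

  entry≤ : ∀ {n} (x : Vec C n) s → entry x s ≤ height s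
  entry≤ x (i , j) = coord≤ v (lookup x i) j

  entry-injective : ∀ {n} {x y : Vec C n} → (∀ s → entry x s ≡ entry y s) → x ≡ y
  entry-injective {x = []}    {[]}    _  = refl
  entry-injective {x = a ∷ x} {b ∷ y} eq =
    cong₂ _∷_ (coord-injective v (λ j → eq (zero , j))) (entry-injective (λ (i , j) → eq (suc i , j)))

  entry-⊕ : ∀ {n} (x y : Vec C n) s → entry (zipWith (_⊕_ A) x y) s ≡ entry x s ⊕⟨ height s ⟩ entry y s
  entry-⊕ x y (i , j) = trans (cong (λ z → coord v z j) (lookup-zipWith _ i x y)) (coord-⊕ v _ _ j)

  entry-⊙ : ∀ {n} (x y : Vec C n) s → entry (zipWith (_⊙_ A) x y) s ≡ entry x s ⊙⟨ height s ⟩ entry y s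
  entry-⊙ x y (i , j) = trans (cong (λ z → coord v z j) (lookup-zipWith _ i x y)) (coord-⊙ v _ _ j)

  entry-¬ : ∀ {n} (x : Vec C n) s → entry (map (neg A) x) s ≡ ¬⟨ height s ⟩ entry x s
  entry-¬ x (i , j) = trans (cong (λ z → coord v z j) (lookup-map i _ x)) (coord-¬ v _ j)

  entry-0 : ∀ n s → entry (replicate n (zero₀ A)) s ≡ 0
  entry-0 n (i , j) = trans (cong (λ z → coord v z j) (lookup-replicate i _)) (coord-0 v j)

  entry-1 : ∀ n s → entry (replicate n (one₁ A)) s ≡ height s
  entry-1 n (i , j) = trans (cong (λ z → coord v z j) (lookup-replicate i _)) (coord-1 v j)

  entry-minorMap : ∀ {n m} (τ : Fin n → Fin m) (x : Vec C m) i j → entry (minorMap τ x) (i , j) ≡ entry x (τ i , j)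
  entry-minorMap τ x i j = cong (λ z → coord v z j) (lookup∘tabulate _ i)

  out : (h : Hom A) → Vec C (suc (ar h)) → Fin (suc t) → ℕ
  out h x = coord v (fn h x)

  out≤ : ∀ h x j → out h x j ≤ c j
  out≤ h x = coord≤ v (fn h x)

  out-⊕ : ∀ h x y j → out h (zipWith (_⊕_ A) x y) j ≡ out h x j ⊕⟨ c j ⟩ out h y j
  out-⊕ h x y j = trans (cong (λ z → coord v z j) (pres-⊕ h x y)) (coord-⊕ v _ _ j)

  out-⊙ : ∀ h x y j → out h (zipWith (_⊙_ A) x y) j ≡ out h x j ⊙⟨ c j ⟩ out h y j
  out-⊙ h x y j = trans (cong (λ z → coord v z j) (pres-⊙ h x y)) (coord-⊙ v _ _ j)

  out-¬ : ∀ h x j → out h (map (neg A) x) j ≡ ¬⟨ c j ⟩ out h x j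
  out-¬ h x j = trans (cong (λ z → coord v z j) (pres-¬ h x)) (coord-¬ v _ j)

  out-0 : ∀ h j → out h (replicate (suc (ar h)) (zero₀ A)) j ≡ 0
  out-0 h j = trans (cong (λ z → coord v z j) (pres-0 h)) (coord-0 v j)

  out-1 : ∀ h j → out h (replicate (suc (ar h)) (one₁ A)) j ≡ c j
  out-1 h j = trans (cong (λ z → coord v z j) (pres-1 h)) (coord-1 v j)

  point : ∀ {n} → Pos n → ℕ → Vec C n
  point s a = fromEntries (λ r → if does (r ≟ₚ s) then a else 0)

  entry-point-self : ∀ {n} (s : Pos n) {a} → a ≤ height s → entry (point s a) s ≡ a
  entry-point-self s {a} a≤ = begin
    entry (point s a) s                                 ≡⟨ entry-fromEntries _ s ⟩
    height s ⊓ (if does (s ≟ₚ s) then a else 0)         ≡⟨ cong (λ b → height s ⊓ (if b then a else 0)) (dec-true (s ≟ₚ s) refl) ⟩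
    height s ⊓ a                                        ≡⟨ m≥n⇒m⊓n≡n a≤ ⟩
    a                                                   ∎
    where open ≡-Reasoning

  entry-point-other : ∀ {n} {r s : Pos n} a → r ≢ s → entry (point s a) r ≡ 0
  entry-point-other {r = r} {s} a r≢s = begin
    entry (point s a) r                                 ≡⟨ entry-fromEntries _ r ⟩
    height r ⊓ (if does (r ≟ₚ s) then a else 0)         ≡⟨ cong (λ b → height r ⊓ (if b then a else 0)) (dec-false (r ≟ₚ s) r≢s) ⟩
    height r ⊓ 0                                        ≡⟨ ⊓-zeroʳ (height r) ⟩
    0                                                   ∎
    where open ≡-Reasoning

  unit : ∀ {n} → Pos n → Vec C n
  unit s = point s (height s)

  entry-unit-self : ∀ {n} (s : Pos n) → entry (unit s) s ≡ height s
  entry-unit-self s = entry-point-self s ≤-refl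

  unit-⊕-idem : ∀ {n} (s : Pos n) → zipWith (_⊕_ A) (unit s) (unit s) ≡ unit s
  unit-⊕-idem s = entry-injective λ r → trans (entry-⊕ (unit s) (unit s) r) (idem r)
    where
    idem : ∀ r → entry (unit s) r ⊕⟨ height r ⟩ entry (unit s) r ≡ entry (unit s) r
    idem r with r ≟ₚ s
    ... | yes refl rewrite entry-unit-self s = ⊕⟨⟩-absorbs-topˡ (height s) (height s)
    ... | no r≢s   rewrite entry-point-other (height s) r≢s = ⊓-zeroʳ (height r)

  -- Multiplying by a unit isolates one entry: this is what makes homomorphisms coordinate-wise.
  ⊙-unit : ∀ {n} (x : Vec C n) s → zipWith (_⊙_ A) x (unit s) ≡ point s (entry x s)
  ⊙-unit x s = entry-injective λ r → trans (entry-⊙ x (unit s) r) (isolate r)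
    where
    isolate : ∀ r → entry x r ⊙⟨ height r ⟩ entry (unit s) r ≡ entry (point s (entry x s)) r
    isolate r with r ≟ₚ s
    ... | yes refl rewrite entry-unit-self s =
      trans (⊙⟨⟩-identityʳ (entry≤ x s)) (sym (entry-point-self s (entry≤ x s)))
    ... | no r≢s rewrite entry-point-other (height s) r≢s =
      trans (⊙⟨⟩-zeroʳ (entry≤ x r)) (sym (entry-point-other (entry x s) r≢s))

  unitSum : ∀ {n} → List (Pos n) → Vec C n
  unitSum {n} []       = replicate n (zero₀ A)
  unitSum     (s ∷ ss) = zipWith (_⊕_ A) (unit s) (unitSum ss)

  entry-unitSum : ∀ {n} {r : Pos n} {ss} → r ∈ ss → entry (unitSum ss) r ≡ height r
  entry-unitSum {r = r} {s ∷ ss} (here refl) =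
    trans (entry-⊕ (unit s) (unitSum ss) r) (trans (cong (_⊕⟨ height r ⟩ entry (unitSum ss) r) (entry-unit-self r)) (⊕⟨⟩-absorbs-topˡ _ _))
  entry-unitSum {r = r} {s ∷ ss} (there r∈ss) =
    trans (entry-⊕ (unit s) (unitSum ss) r) (trans (cong (entry (unit s) r ⊕⟨ height r ⟩_) (entry-unitSum r∈ss)) (⊕⟨⟩-absorbs-topʳ _ _))

  allPositions : ∀ n → List (Pos n)
  allPositions n = cartesianProduct (allFin n) (allFin (suc t))

  unitSum-allPositions : ∀ n → unitSum (allPositions n) ≡ replicate n (one₁ A)
  unitSum-allPositions n = entry-injective λ (i , j) →
    trans (entry-unitSum (∈-cartesianProduct⁺ (∈-allFin i) (∈-allFin j))) (sym (entry-1 n (i , j)))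

  out-unitSum : ∀ h j → (∀ s → out h (unit s) j ≡ 0) → ∀ ss → out h (unitSum ss) j ≡ 0
  out-unitSum h j vanish []       = out-0 h j
  out-unitSum h j vanish (s ∷ ss) =
    trans (out-⊕ h (unit s) (unitSum ss) j) (trans (cong₂ _⊕⟨ c j ⟩_ (vanish s) (out-unitSum h j vanish ss)) (⊓-zeroʳ (c j)))

  some-unit-survives : ∀ h j → ¬ (∀ s → out h (unit s) j ≡ 0)
  some-unit-survives h j vanish = <⇒≢ (v-positive j) (begin
    0                                      ≡⟨ out-unitSum h j vanish (allPositions _) ⟨
    out h (unitSum (allPositions _)) j     ≡⟨ cong (λ x → out h x j) (unitSum-allPositions _) ⟩
    out h (replicate _ (one₁ A)) j         ≡⟨ out-1 h j ⟩
    c j                                    ∎)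
    where open ≡-Reasoning

  -- Output j of h depends only on the entry at this position (out-support).
  support : (h : Hom A) → Fin (suc t) → Pos (suc (ar h))
  support h j = proj₁ (¬∀⟶∃¬-× _ _ _ (λ s → out h (unit s) j ≟ 0) (some-unit-survives h j))

  out-unit-support≢0 : ∀ h j → out h (unit (support h j)) j ≢ 0
  out-unit-support≢0 h j = proj₂ (¬∀⟶∃¬-× _ _ _ (λ s → out h (unit s) j ≟ 0) (some-unit-survives h j))

  module Classification (h : Hom A) (j : Fin (suc t)) where

    s : Pos (suc (ar h))
    s = support h j

    out-unit-support : out h (unit s) j ≡ c j
    out-unit-support = ⊕⟨⟩-idempotent⇒top
      (trans (sym (out-⊕ h (unit s) (unit s) j)) (cong (λ x → out h x j) (unit-⊕-idem s)))
      (out-unit-support≢0 h j)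

    φ : ℕ → ℕ
    φ a = out h (point s a) j

    out-via-φ : ∀ x → out h x j ≡ φ (entry x s)
    out-via-φ x = begin
      out h x j                                ≡⟨ ⊙⟨⟩-identityʳ (out≤ h x j) ⟨
      out h x j ⊙⟨ c j ⟩ c j                   ≡⟨ cong (out h x j ⊙⟨ c j ⟩_) out-unit-support ⟨
      out h x j ⊙⟨ c j ⟩ out h (unit s) j      ≡⟨ out-⊙ h x (unit s) j ⟨
      out h (zipWith (_⊙_ A) x (unit s)) j     ≡⟨ cong (λ y → out h y j) (⊙-unit x s) ⟩
      φ (entry x s)                            ∎
      where open ≡-Reasoning

    φ-⊕ : ∀ {a b} → a ≤ height s → b ≤ height s → φ (a ⊕⟨ height s ⟩ b) ≡ φ a ⊕⟨ c j ⟩ φ b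
    φ-⊕ {a} {b} a≤ b≤ = begin
      φ (a ⊕⟨ height s ⟩ b)
        ≡⟨ cong φ (cong₂ _⊕⟨ height s ⟩_ (entry-point-self s a≤) (entry-point-self s b≤)) ⟨
      φ (entry (point s a) s ⊕⟨ height s ⟩ entry (point s b) s)
        ≡⟨ cong φ (entry-⊕ (point s a) (point s b) s) ⟨
      φ (entry (zipWith (_⊕_ A) (point s a) (point s b)) s)
        ≡⟨ out-via-φ _ ⟨
      out h (zipWith (_⊕_ A) (point s a) (point s b)) j
        ≡⟨ out-⊕ h (point s a) (point s b) j ⟩
      φ a ⊕⟨ c j ⟩ φ b
        ∎
      where open ≡-Reasoning

    φ-¬ : ∀ {a} → a ≤ height s → φ (¬⟨ height s ⟩ a) ≡ ¬⟨ c j ⟩ φ a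
    φ-¬ {a} a≤ = begin
      φ (¬⟨ height s ⟩ a)                           ≡⟨ cong (λ b → φ (¬⟨ height s ⟩ b)) (entry-point-self s a≤) ⟨
      φ (¬⟨ height s ⟩ entry (point s a) s)         ≡⟨ cong φ (entry-¬ (point s a) s) ⟨
      φ (entry (map (neg A) (point s a)) s)         ≡⟨ out-via-φ _ ⟨
      out h (map (neg A) (point s a)) j             ≡⟨ out-¬ h (point s a) j ⟩
      ¬⟨ c j ⟩ φ a                                  ∎
      where open ≡-Reasoning

    open ChainHom (v-positive j) (v-positive (proj₂ s)) φ out-unit-support φ-⊕ φ-¬ public
      using (slope; slope≡c/c'; c'∣c; φ-linear)

  ratio : Fin (suc t) → Fin (suc t) → ℕ
  ratio j j' = _/_ (c j) (c j') {{>-nonZero (v-positive j')}}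

  c≡c'*ratio : ∀ j j' → c j' ∣ c j → c j ≡ c j' * ratio j j'
  c≡c'*ratio j j' c'∣c = sym (m*[n/m]≡n {{>-nonZero (v-positive j')}} c'∣c)

  support-∣ : ∀ h j → height (support h j) ∣ c j
  support-∣ = Classification.c'∣c

  out-support : ∀ h j x → out h x j ≡ entry x (support h j) * ratio j (proj₂ (support h j))
  out-support h j x = trans (out-via-φ x) (trans (φ-linear (entry≤ x s)) (cong (entry x s *_) slope≡c/c'))
    where open Classification h j

  top≢0 : ∀ {x} j → x ≡ c j → x ≢ 0
  top≢0 j x≡c x≡0 = <⇒≢ (v-positive j) (trans (sym x≡0) x≡c)

  support-unique : ∀ h j s → out h (unit s) j ≢ 0 → support h j ≡ s
  support-unique h j s out≢0 = decidable-stable (support h j ≟ₚ s) λ support≢s →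
    out≢0 (trans (out-support h j (unit s))
                 (cong (_* ratio j (proj₂ (support h j))) (entry-point-other (height s) support≢s)))

  module FromSupport (n : ℕ) (σ : Fin (suc t) → Pos (suc n)) (σ-∣ : ∀ j → height (σ j) ∣ c j) where

    scale : Fin (suc t) → ℕ
    scale j = ratio j (proj₂ (σ j))

    value : Vec C (suc n) → Fin (suc t) → ℕ
    value x j = entry x (σ j) * scale j

    c≡height*scale : ∀ j → c j ≡ height (σ j) * scale j
    c≡height*scale j = c≡c'*ratio j (proj₂ (σ j)) (σ-∣ j)

    value≤ : ∀ x j → value x j ≤ c j
    value≤ x j = subst (value x j ≤_) (sym (c≡height*scale j)) (*-monoˡ-≤ _ (entry≤ x (σ j)))

    F : Vec C (suc n) → C
    F x = fromCoords v (value x)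

    coord-F : ∀ x j → coord v (F x) j ≡ value x j
    coord-F x j = trans (coord-fromCoords v _ j) (m≥n⇒m⊓n≡n (value≤ x j))

    value-⊕ : ∀ x y j → value (zipWith (_⊕_ A) x y) j ≡ value x j ⊕⟨ c j ⟩ value y j
    value-⊕ x y j = trans (cong (_* scale j) (entry-⊕ x y (σ j)))
      (trans (*-distribʳ-⊕⟨⟩ (scale j) (height (σ j)) (entry x (σ j)) (entry y (σ j))) (cong (λ m → value x j ⊕⟨ m ⟩ value y j) (sym (c≡height*scale j))))

    value-⊙ : ∀ x y j → value (zipWith (_⊙_ A) x y) j ≡ value x j ⊙⟨ c j ⟩ value y j
    value-⊙ x y j = trans (cong (_* scale j) (entry-⊙ x y (σ j)))
      (trans (*-distribʳ-⊙⟨⟩ (scale j) (height (σ j)) (entry x (σ j)) (entry y (σ j))) (cong (λ m → value x j ⊙⟨ m ⟩ value y j) (sym (c≡height*scale j))))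

    value-¬ : ∀ x j → value (map (neg A) x) j ≡ ¬⟨ c j ⟩ value x j
    value-¬ x j = trans (cong (_* scale j) (entry-¬ x (σ j)))
      (trans (*-distribʳ-¬⟨⟩ (scale j) (height (σ j)) (entry x (σ j))) (cong (λ m → ¬⟨ m ⟩ value x j) (sym (c≡height*scale j))))

    value-1 : ∀ j → value (replicate (suc n) (one₁ A)) j ≡ c j
    value-1 j = trans (cong (_* scale j) (entry-1 (suc n) (σ j))) (sym (c≡height*scale j))

    hom : Hom A
    hom = record
      { ar     = n
      ; fn     = F
      ; pres-⊕ = λ x y → coord-injective v λ j → trans (coord-F (zipWith (_⊕_ A) x y) j) (trans (value-⊕ x y j)
                   (sym (trans (coord-⊕ v (F x) (F y) j) (cong₂ _⊕⟨ c j ⟩_ (coord-F x j) (coord-F y j)))))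
      ; pres-⊙ = λ x y → coord-injective v λ j → trans (coord-F (zipWith (_⊙_ A) x y) j) (trans (value-⊙ x y j)
                   (sym (trans (coord-⊙ v (F x) (F y) j) (cong₂ _⊙⟨ c j ⟩_ (coord-F x j) (coord-F y j)))))
      ; pres-¬ = λ x → coord-injective v λ j → trans (coord-F (map (neg A) x) j) (trans (value-¬ x j)
                   (sym (trans (coord-¬ v (F x) j) (cong (¬⟨ c j ⟩_) (coord-F x j)))))
      ; pres-0 = coord-injective v λ j → trans (coord-F (replicate (suc n) (zero₀ A)) j)
                   (trans (cong (_* scale j) (entry-0 (suc n) (σ j))) (sym (coord-0 v j)))
      ; pres-1 = coord-injective v λ j → trans (coord-F (replicate (suc n) (one₁ A)) j) (trans (value-1 j) (sym (coord-1 v j)))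
      }

    support-hom : ∀ j → support hom j ≡ σ j
    support-hom j = support-unique hom j (σ j) (top≢0 j (begin
      out hom (unit (σ j)) j          ≡⟨ coord-F (unit (σ j)) j ⟩
      value (unit (σ j)) j            ≡⟨ cong (_* scale j) (trans (entry-unit-self (σ j)) (sym (entry-1 (suc n) (σ j)))) ⟩
      value (replicate _ (one₁ A)) j  ≡⟨ value-1 j ⟩
      c j                             ∎))
      where open ≡-Reasoning

  fromSupport : (n : ℕ) (σ : Fin (suc t) → Pos (suc n)) → (∀ j → height (σ j) ∣ c j) → Hom A
  fromSupport = FromSupport.hom

  support-fromSupport : ∀ n σ σ-∣ j → support (fromSupport n σ σ-∣) j ≡ σ j
  support-fromSupport = FromSupport.support-hom

  out-fromSupport : ∀ n σ σ-∣ x j → out (fromSupport n σ σ-∣) x j ≡ entry x (σ j) * ratio j (proj₂ (σ j))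
  out-fromSupport = FromSupport.coord-F

  support-minor : ∀ g f ((τ , _) : g ⪯ f) j → support g j ≡ (τ (proj₁ (support f j)) , proj₂ (support f j))
  support-minor g f (τ , g≡f∘τ) j = support-unique g j s' (top≢0 j (begin
    out g (unit s') j                                  ≡⟨ cong (λ z → coord v z j) (g≡f∘τ (unit s')) ⟩
    out f (minorMap τ (unit s')) j                     ≡⟨ out-support f j (minorMap τ (unit s')) ⟩
    entry (minorMap τ (unit s')) (i , j') * ratio j j' ≡⟨ cong (_* ratio j j') (entry-minorMap τ (unit s') i j') ⟩
    entry (unit s') s' * ratio j j'                    ≡⟨ cong (_* ratio j j') (entry-unit-self s') ⟩
    c j' * ratio j j'                                  ≡⟨ c≡c'*ratio j j' (support-∣ f j) ⟨
    c j                                                ∎))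
    where
    open ≡-Reasoning
    i  = proj₁ (support f j)
    j' = proj₂ (support f j)
    s' = (τ i , j')

  fromSupport-minor : ∀ {n m} (τ : Fin (suc m) → Fin (suc n)) σ σ' σ-∣ σ'-∣ →
                      (∀ j → σ j ≡ (τ (proj₁ (σ' j)) , proj₂ (σ' j))) →
                      fromSupport n σ σ-∣ ⪯ fromSupport m σ' σ'-∣
  fromSupport-minor {n} {m} τ σ σ' σ-∣ σ'-∣ σ≡τσ' = τ , λ a → coord-injective v λ j → begin
    out (fromSupport n σ σ-∣) a j
      ≡⟨ out-fromSupport n σ σ-∣ a j ⟩
    entry a (σ j) * ratio j (proj₂ (σ j))
      ≡⟨ cong (λ s → entry a s * ratio j (proj₂ s)) (σ≡τσ' j) ⟩
    entry a (τ (proj₁ (σ' j)) , proj₂ (σ' j)) * ratio j (proj₂ (σ' j))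
      ≡⟨ cong (_* ratio j (proj₂ (σ' j))) (entry-minorMap τ a _ _) ⟨
    entry (minorMap τ a) (σ' j) * ratio j (proj₂ (σ' j))
      ≡⟨ out-fromSupport m σ' σ'-∣ (minorMap τ a) j ⟨
    out (fromSupport m σ' σ'-∣) (minorMap τ a) j
      ∎
    where open ≡-Reasoning

  fromSupport-≋ : ∀ h σ σ-∣ → (∀ j → σ j ≡ support h j) → fromSupport (ar h) σ σ-∣ ≋ h
  fromSupport-≋ h σ σ-∣ σ≡support =
      ((λ i → i) , λ a → trans (fn-≡ a) (cong (fn h) (sym (tabulate∘lookup a))))
    , ((λ i → i) , λ a → trans (sym (fn-≡ a)) (cong (fn (fromSupport (ar h) σ σ-∣)) (sym (tabulate∘lookup a))))
    where
    fn-≡ : ∀ a → fn (fromSupport (ar h) σ σ-∣) a ≡ fn h a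
    fn-≡ a = coord-injective v λ j → begin
      out (fromSupport (ar h) σ σ-∣) a j                          ≡⟨ out-fromSupport (ar h) σ σ-∣ a j ⟩
      entry a (σ j) * ratio j (proj₂ (σ j))                       ≡⟨ cong (λ s → entry a s * ratio j (proj₂ s)) (σ≡support j) ⟩
      entry a (support h j) * ratio j (proj₂ (support h j))       ≡⟨ out-support h j a ⟨
      out h a j                                                   ∎
      where open ≡-Reasoning

DivisibilityPreserved : ∀ {t} → Vec ℕ (suc t) → Vec ℕ (suc t) → Set
DivisibilityPreserved v w = ∀ j j' → lookup v j' ∣ lookup v j → lookup w j' ∣ lookup w j

module Transport {t} (v w : Vec ℕ (suc t)) (v-positive : ∀ j → 1 ≤ lookup v j) (w-positive : ∀ j → 1 ≤ lookup w j)
  (v→w : DivisibilityPreserved v w) where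

  private
    module V = ProductHoms v v-positive
    module W = ProductHoms w w-positive

  support-∣-transported : ∀ f j → W.height (V.support f j) ∣ lookup w j
  support-∣-transported f j = v→w j _ (V.support-∣ f j)

  transport : Hom (ProdL v) → Hom (ProdL w)
  transport f = W.fromSupport (ar f) (V.support f) (support-∣-transported f)

  transport-mono : ∀ g f → g ⪯ f → transport g ⪯ transport f
  transport-mono g f g⪯f =
    W.fromSupport-minor (proj₁ g⪯f) (V.support g) (V.support f)
      (support-∣-transported g) (support-∣-transported f) (V.support-minor g f g⪯f)

  support-transport : ∀ f j → W.support (transport f) j ≡ V.support f j
  support-transport f = W.support-fromSupport (ar f) (V.support f) (support-∣-transported f)

module _ {t} (v w : Vec ℕ (suc t)) (v-positive : ∀ j → 1 ≤ lookup v j) (w-positive : ∀ j → 1 ≤ lookup w j)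
  (v→w : DivisibilityPreserved v w) (w→v : DivisibilityPreserved w v) where

  private
    module V→W = Transport v w v-positive w-positive v→w
    module W→V = Transport w v w-positive v-positive w→v

  transport-inverse : ∀ f → W→V.transport (V→W.transport f) ≋ f
  transport-inverse f = ProductHoms.fromSupport-≋ v v-positive f _
    (W→V.support-∣-transported (V→W.transport f)) (V→W.support-transport f)

minorPosetIso : ∀ {t} (v w : Vec ℕ (suc t)) → (∀ j → 1 ≤ lookup v j) → (∀ j → 1 ≤ lookup w j) →
                DivisibilityPreserved v w → DivisibilityPreserved w v → MinorPosetIso (ProdL v) (ProdL w)
minorPosetIso v w v-positive w-positive v→w w→v =
    V→W.transport
  , W→V.transport
  , V→W.transport-mono
  , W→V.transport-mono
  , transport-inverse v w v-positive w-positive v→w w→v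
  , transport-inverse w v w-positive v-positive w→v v→w
  where
  module V→W = Transport v w v-positive w-positive v→w
  module W→V = Transport w v w-positive v-positive w→v

prime≢1 : ∀ {p} → Prime p → p ≢ 1
prime≢1 p-prime = nonTrivial⇒≢1 {{prime⇒nonTrivial p-prime}}

prime∣prime⇒≡ : ∀ {r p} → Prime r → Prime p → r ∣ p → r ≡ p
prime∣prime⇒≡ r-prime p-prime r∣p with prime⇒irreducible p-prime r∣p
... | inj₁ r≡1 = ⊥-elim (prime≢1 r-prime r≡1)
... | inj₂ r≡p = r≡p

prime∣m^n⇒∣m : ∀ {r} m n → Prime r → r ∣ m ^ n → r ∣ m
prime∣m^n⇒∣m m zero    r-prime r∣1 = ⊥-elim (prime≢1 r-prime (∣1⇒≡1 r∣1))
prime∣m^n⇒∣m m (suc n) r-prime r∣m^1+n with euclidsLemma m (m ^ n) r-prime r∣m^1+n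
... | inj₁ r∣m   = r∣m
... | inj₂ r∣m^n = prime∣m^n⇒∣m m n r-prime r∣m^n

prime^e∣m*n∧∤n⇒∣m : ∀ {r} e m n → Prime r → ¬ r ∣ n → r ^ e ∣ m * n → r ^ e ∣ m
prime^e∣m*n∧∤n⇒∣m zero    m n _       _   _ = 1∣ m
prime^e∣m*n∧∤n⇒∣m {r} (suc e) m n r-prime r∤n r^1+e∣mn
  with euclidsLemma m n r-prime (∣-trans (m∣m*n (r ^ e)) r^1+e∣mn)
... | inj₂ r∣n = ⊥-elim (r∤n r∣n)
... | inj₁ (divides m' refl) =
  subst (r ^ suc e ∣_) (*-comm r m') (*-monoʳ-∣ r (prime^e∣m*n∧∤n⇒∣m e m' n r-prime r∤n r^e∣m'n))
  where
  instance _ = prime⇒nonZero r-prime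
  r^e∣m'n : r ^ e ∣ m' * n
  r^e∣m'n = *-cancelˡ-∣ r (subst (r * r ^ e ∣_) (trans (cong (_* n) (*-comm m' r)) (*-assoc r m' n)) r^1+e∣mn)

m^n∣m^o⇒n≤o : ∀ {m} n o → 1 < m → m ^ n ∣ m ^ o → n ≤ o
m^n∣m^o⇒n≤o {m@(suc _)} n o 1<m m^n∣m^o with ≤-<-connex n o
... | inj₁ n≤o = n≤o
... | inj₂ o<n = ⊥-elim (<⇒≱ (^-monoʳ-< m 1<m o<n) (∣⇒≤ {{m^n≢0 m o}} m^n∣m^o))

n≤o⇒m^n∣m^o : ∀ m {n o} → n ≤ o → m ^ n ∣ m ^ o
n≤o⇒m^n∣m^o m {n} {o} n≤o =
  subst (m ^ n ∣_) (trans (sym (^-distribˡ-+-* m n (o ∸ n))) (cong (m ^_) (m+[n∸m]≡n n≤o))) (m∣m*n _)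

∏-positive : ∀ k (f : Fin k → ℕ) → (∀ i → 1 ≤ f i) → 1 ≤ ∏ k f
∏-positive zero    f _     = s≤s z≤n
∏-positive (suc k) f 1≤f = *-mono-≤ (1≤f zero) (∏-positive k (λ i → f (suc i)) (λ i → 1≤f (suc i)))

primePow-positive : ∀ k (p β : Fin k → ℕ) → (∀ i → Prime (p i)) → 1 ≤ primePow k p β
primePow-positive k p β p-prime = ∏-positive k _ (λ i → m^n>0 (p i) {{prime⇒nonZero (p-prime i)}} (β i))

f∣∏f : ∀ k (f : Fin k → ℕ) i → f i ∣ ∏ k f
f∣∏f (suc k) f zero    = m∣m*n _
f∣∏f (suc k) f (suc i) = ∣-trans (f∣∏f k (λ i → f (suc i)) i) (n∣m*n (f zero))

prime∤primePow : ∀ k (p β : Fin k → ℕ) {r} → Prime r → (∀ i → Prime (p i)) →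
                 (∀ i → r ≢ p i) → ¬ r ∣ primePow k p β
prime∤primePow zero    p β r-prime _       _   r∣1 = prime≢1 r-prime (∣1⇒≡1 r∣1)
prime∤primePow (suc k) p β r-prime p-prime r≢p r∣∏ with euclidsLemma (p zero ^ β zero) _ r-prime r∣∏
... | inj₁ r∣p₀^β₀ = r≢p zero (prime∣prime⇒≡ r-prime (p-prime zero) (prime∣m^n⇒∣m (p zero) (β zero) r-prime r∣p₀^β₀))
... | inj₂ r∣rest  = prime∤primePow k (λ i → p (suc i)) (λ i → β (suc i)) r-prime
                       (λ i → p-prime (suc i)) (λ i → r≢p (suc i)) r∣rest

p^e∣primePow⇒e≤β : ∀ k (p β : Fin k → ℕ) → (∀ i → Prime (p i)) → Injective _≡_ _≡_ p →
                   ∀ i e → p i ^ e ∣ primePow k p β → e ≤ β i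
p^e∣primePow⇒e≤β (suc k) p β p-prime p-inj zero e p₀^e∣∏ =
  m^n∣m^o⇒n≤o e (β zero) (nonTrivial⇒n>1 (p zero) {{prime⇒nonTrivial (p-prime zero)}})
    (prime^e∣m*n∧∤n⇒∣m e _ _ (p-prime zero) p₀∤rest p₀^e∣∏)
  where
  p₀∤rest : ¬ p zero ∣ primePow k (λ i → p (suc i)) (λ i → β (suc i))
  p₀∤rest = prime∤primePow k _ (λ i → β (suc i)) (p-prime zero) (λ i → p-prime (suc i)) (λ i p₀≡pᵢ → Fin.0≢1+n (p-inj p₀≡pᵢ))
p^e∣primePow⇒e≤β (suc k) p β p-prime p-inj (suc i) e pᵢ^e∣∏ =
  p^e∣primePow⇒e≤β k (λ i → p (suc i)) (λ i → β (suc i)) (λ i → p-prime (suc i)) (λ eq → Fin.suc-injective (p-inj eq)) i e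
    (prime^e∣m*n∧∤n⇒∣m e _ (p zero ^ β zero) (p-prime (suc i)) pᵢ∤p₀^β₀
      (subst (p (suc i) ^ e ∣_) (*-comm (p zero ^ β zero) _) pᵢ^e∣∏))
  where
  pᵢ∤p₀^β₀ : ¬ p (suc i) ∣ p zero ^ β zero
  pᵢ∤p₀^β₀ pᵢ∣p₀^β₀ = Fin.0≢1+n (sym (p-inj (prime∣prime⇒≡ (p-prime (suc i)) (p-prime zero)
                        (prime∣m^n⇒∣m (p zero) (β zero) (p-prime (suc i)) pᵢ∣p₀^β₀))))

primePow-∣⇒≤ : ∀ k (p β γ : Fin k → ℕ) → (∀ i → Prime (p i)) → Injective _≡_ _≡_ p →
               primePow k p β ∣ primePow k p γ → ∀ i → β i ≤ γ i
primePow-∣⇒≤ k p β γ p-prime p-inj β∣γ i =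
  p^e∣primePow⇒e≤β k p γ p-prime p-inj i (β i) (∣-trans (f∣∏f k (λ i → p i ^ β i) i) β∣γ)

≤⇒primePow-∣ : ∀ k (p β γ : Fin k → ℕ) → (∀ i → β i ≤ γ i) → primePow k p β ∣ primePow k p γ
≤⇒primePow-∣ zero    p β γ _   = ∣-refl
≤⇒primePow-∣ (suc k) p β γ β≤γ = *-pres-∣ (n≤o⇒m^n∣m^o (p zero) (β≤γ zero))
  (≤⇒primePow-∣ k (λ i → p (suc i)) (λ i → β (suc i)) (λ i → γ (suc i)) (λ i → β≤γ (suc i)))

tabulate-divisibilityPreserved : ∀ {t} (f g : Fin (suc t) → ℕ) → (∀ j j' → f j' ∣ f j → g j' ∣ g j) →
                                 DivisibilityPreserved (tabulate f) (tabulate g)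
tabulate-divisibilityPreserved f g f→g j j' f∣ =
  subst₂ _∣_ (sym (lookup∘tabulate g j')) (sym (lookup∘tabulate g j))
    (f→g j j' (subst₂ _∣_ (lookup∘tabulate f j') (lookup∘tabulate f j) f∣))

primePow-∣-transfer : ∀ k (p q : Fin k → ℕ) → (∀ i → Prime (p i)) → Injective _≡_ _≡_ p →
                      ∀ β γ → primePow k p β ∣ primePow k p γ → primePow k q β ∣ primePow k q γ
primePow-∣-transfer k p q p-prime p-inj β γ p^β∣p^γ =
  ≤⇒primePow-∣ k q β γ (primePow-∣⇒≤ k p β γ p-prime p-inj p^β∣p^γ)

-- The bounds β j i ≤ α i only say that every m_j divides m; the argument does not use them.
proposition5p20 :
    (k : ℕ) (p q α : Fin k → ℕ) →
    (∀ i → Prime (p i)) → Injective _≡_ _≡_ p →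
    (∀ i → Prime (q i)) → Injective _≡_ _≡_ q →
    (∀ i → 1 ≤ α i) →
    (t : ℕ) (β : Fin (suc t) → Fin k → ℕ) →
    (∀ j i → β j i ≤ α i) →
    MinorPosetIso
      (ProdL (tabulate (λ j → primePow k p (β j))))
      (ProdL (tabulate (λ j → primePow k q (β j))))
proposition5p20 k p q _ p-prime p-inj q-prime q-inj _ t β _ =
  minorPosetIso (m p) (m q) (m-positive p-prime) (m-positive q-prime)
    (tabulate-divisibilityPreserved _ _ (λ j j' → primePow-∣-transfer k p q p-prime p-inj (β j') (β j)))
    (tabulate-divisibilityPreserved _ _ (λ j j' → primePow-∣-transfer k q p q-prime q-inj (β j') (β j)))
  where
  m : (Fin k → ℕ) → Vec ℕ (suc t)
  m r = tabulate (λ j → primePow k r (β j))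
  m-positive : ∀ {r} → (∀ i → Prime (r i)) → ∀ j → 1 ≤ lookup (m r) j
  m-positive {r} r-prime j = subst (1 ≤_) (sym (lookup∘tabulate (λ j → primePow k r (β j)) j)) (primePow-positive k r (β j) r-prime)
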